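{- Let $k\geq 3$ and $i\in[k-1]$, and let $p=(A/B)$ be the complete bipartite partially ordered pattern of length $k$ with $A=\{i,i+1\}$ and $B=[k]\setminus A$. Let $a(n)$ denote the number of permutations of $[n]$ avoiding $p$. Then $$a(n)=\begin{cases} n! & \text{if } n<k,\\ 2(k-2)\,a(n-1)-(k-2)(k-3)\,a(n-2) & \text{if } n\geq k.\end{cases}$$
   Context: For $A\subset[k]$ and $B=[k]\setminus A$, the complete bipartite partially ordered pattern $(A/B)$ of length $k$ is defined as follows: an occurrence of $(A/B)$ in a permutation $\pi=\pi_1\cdots\pi_n$ is a subsequence $\pi_{i_1}\pi_{i_2}\cdots\pi_{i_k}$ with $1\le i_1<\cdots<i_k\le n$ such that $\pi_{i_a}>\pi_{i_b}$ for every $a\in A$ and every $b\in B$. A permutation avoids the pattern if it has no occurrence of it. Here $[m]=\{1,\dots,m\}$ and the empty permutation is counted for $n=0$. -}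

module Defs where

open import Data.Nat using (ℕ; zero; suc; _<_)
open import Data.Fin using (Fin; toℕ)
open import Data.List using (List; length; lookup; applyUpTo)
open import Data.List.Relation.Binary.Sublist.Propositional using (_⊆_)
open import Data.List.Relation.Binary.Permutation.Propositional using (_↭_)
open import Data.List.Relation.Unary.Unique.Propositional using (Unique)
open import Data.List.Membership.Propositional using (_∈_)
open import Data.Product using (Σ; _×_; Σ-syntax)
open import Function.Bundles using (_⇔_)
open import Relation.Nullary using (¬_)
open import Relation.Binary.PropositionalEquality using (_≡_)

-- A permutation of [n] = {1,…,n}, in one-line notation, is a list of
-- naturals that is a rearrangement of [1, 2, …, n].
IsPermOf : ℕ → List ℕ → Set
IsPermOf n w = w ↭ applyUpTo suc n

-- Complete bipartite POP (A/B) of length k, with A ⊆ [k] given as a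
-- predicate on ℕ (positions 1..k) and B = [k] \ A.
-- An occurrence in w is a subsequence s of w (s ⊆ w as a sublist,
-- i.e. entries at positions i₁ < … < i_k) of length k such that
-- s_a > s_b whenever a ∈ A and b ∈ [k] \ A (positions 1-indexed).
OccursCBP : ℕ → (ℕ → Set) → List ℕ → Set
OccursCBP k A w =
  Σ[ s ∈ List ℕ ] (s ⊆ w × length s ≡ k ×
    (∀ (a b : Fin (length s)) → A (suc (toℕ a)) → ¬ A (suc (toℕ b)) →
       lookup s b < lookup s a))

AvoidsCBP : ℕ → (ℕ → Set) → List ℕ → Set
AvoidsCBP k A w = ¬ OccursCBP k A w

Pair : ℕ → ℕ → Set
Pair i x = (x ≡ i) Data.Sum.⊎ (x ≡ suc i)
  where import Data.Sum

-- "m is the number of lists w satisfying P": there is a duplicate-free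
-- list of length m whose members are exactly the w satisfying P.
NumberOf : (List ℕ → Set) → ℕ → Set
NumberOf P m =
  Σ[ L ∈ List (List ℕ) ] (Unique L × (∀ w → (w ∈ L) ⇔ P w) × length L ≡ m)

{-# OPTIONS --safe #-}
-- Write i = α + 1 and k = α + β + 2, so that an occurrence of the pattern is a subsequence
-- L p q R with |L| = α, |R| = β and every entry of L and R below both p and q.  Every
-- avoider of length n + 1 arises, exactly once, by inserting n + 1 into a free slot of an
-- avoider σ of length n, i.e. a slot where the insertion creates no occurrence.  Call a slot
-- flanked if at least α entries lie to its left and β to its right, and put c = α + β.
-- When c ≤ n + 1, exactly c slots are unflanked, and they are all free.  Inserting into an
-- unflanked slot keeps every free slot free and adds one more; inserting into a flanked free
-- slot leaves exactly the c unflanked slots free.  So if σ has c + m free slots, its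
-- children have c (c + m + 1) + c m free slots in total, and summing over all avoiders gives
-- a(n+2) = c (a(n+1) + a(n)) + c a(n+1) - c² a(n), which is the recurrence as c = k - 2.
-- Below length k every slot is free, so a(n) = n!.
module Submission where

open import Defs
open import Algebra.Bundles using (CommutativeMonoid)
open import Data.Bool using (Bool; true; false; not; _∧_; _∨_; if_then_else_; T?)
open import Data.Bool.ListAction using (any)
open import Data.Bool.Properties using (∨-commutativeMonoid; T-≡; T-not-≡)
open import Data.Fin using (Fin; toℕ; zero; suc)
open import Data.List
  using (List; []; _∷_; _++_; [_]; length; lookup; map; concatMap; filterᵇ; take; drop; applyUpTo; downFrom)
open import Data.List.Properties
  using (length-++; length-map; length-take; length-drop; length-applyUpTo; length-downFrom; ++-assoc; ∷-injective;
         take-[]; drop-[]; take-take; drop-drop; take++drop≡id; applyUpTo-∷ʳ)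
open import Data.List.Membership.Propositional using (_∈_; find; lose)
open import Data.List.Membership.Propositional.Properties
  using (∈-++⁺ʳ; ∈-∃++; ∈-lookup; ∈-map⁺; ∈-map⁻; ∈-concatMap⁺; ∈-concatMap⁻; ∈-filter⁺; ∈-filter⁻;
         ∈-applyUpTo⁺; ∈-applyUpTo⁻; ∈-downFrom⁺; ∈-downFrom⁻)
open import Data.List.Membership.Propositional.Properties.WithK using (unique∧set⇒bag)
open import Data.List.Relation.Unary.Any using (here; there)
import Data.List.Relation.Unary.Any as Any
open import Data.List.Relation.Unary.Any.Properties using (any⁺; any⁻; lookup-index)
open import Data.List.Relation.Unary.All using (All; []; _∷_)
import Data.List.Relation.Unary.All as All
import Data.List.Relation.Unary.All.Properties as Allₚ
open import Data.List.Relation.Unary.AllPairs using ([]; _∷_)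
open import Data.List.Relation.Unary.Unique.Propositional using (Unique)
import Data.List.Relation.Unary.Unique.Propositional.Properties as Unique
open import Data.List.Relation.Binary.Sublist.Propositional using (_⊆_; []; _∷_; _∷ʳ_; ⊆-refl; ⊆-trans)
import Data.List.Relation.Binary.Sublist.Propositional.Properties as Sublist
open import Data.List.Relation.Binary.Permutation.Propositional using (_↭_; ↭-refl; ↭-sym; ↭-trans; prep)
open import Data.List.Relation.Binary.Permutation.Propositional.Properties
  using (∈-resp-↭; ↭-length; ↭-empty-inv; shift; drop-∷; ∷↭∷ʳ)
open import Data.List.Relation.Binary.BagAndSetEquality using (∼bag⇒↭)
open import Data.Nat using (ℕ; zero; suc; _+_; _*_; _∸_; _⊓_; _!; _≤_; _≰_; _<_; z≤n; s≤s; _<?_; _≤?_)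
open import Data.Nat.Properties
open import Data.Nat.Tactic.RingSolver using (solve-∀)
open import Data.Product using (Σ-syntax; ∃₂; _×_; _,_; proj₁; proj₂; swap)
open import Data.Sum using (_⊎_; inj₁; inj₂; [_,_]′)
open import Function using (_∘_)
open import Function.Bundles using (Equivalence; _⇔_; mk⇔)
open import Relation.Nullary using (¬_; does; yes; no; contradiction)
open import Relation.Nullary.Decidable using (dec-true; dec-false)
open import Relation.Binary.PropositionalEquality hiding ([_])
import Algebra.Properties.CommutativeSemigroup +-commutativeSemigroup as +
import Algebra.Properties.CommutativeSemigroup (CommutativeMonoid.commutativeSemigroup ∨-commutativeMonoid) as ∨

-- Finite sums and counts

∑ : {A : Set} → (A → ℕ) → List A → ℕ
∑ f []       = 0
∑ f (x ∷ xs) = f x + ∑ f xs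

𝟙 : Bool → ℕ
𝟙 b = if b then 1 else 0

count : {A : Set} → (A → Bool) → List A → ℕ
count p = ∑ (λ x → 𝟙 (p x))

module _ {A : Set} where

  ∑-cong : ∀ {f g : A → ℕ} xs → (∀ {x} → x ∈ xs → f x ≡ g x) → ∑ f xs ≡ ∑ g xs
  ∑-cong []       _  = refl
  ∑-cong (x ∷ xs) eq = cong₂ _+_ (eq (here refl)) (∑-cong xs (eq ∘ there))

  ∑-+ : ∀ (f g : A → ℕ) xs → ∑ (λ x → f x + g x) xs ≡ ∑ f xs + ∑ g xs
  ∑-+ f g []       = refl
  ∑-+ f g (x ∷ xs) =
    trans (cong (f x + g x +_) (∑-+ f g xs)) (+.interchange (f x) (g x) (∑ f xs) (∑ g xs))

  ∑-* : ∀ c (f : A → ℕ) xs → ∑ (λ x → c * f x) xs ≡ c * ∑ f xs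
  ∑-* c f []       = sym (*-zeroʳ c)
  ∑-* c f (x ∷ xs) = trans (cong (c * f x +_) (∑-* c f xs)) (sym (*-distribˡ-+ c (f x) _))

  ∑-const : ∀ c (xs : List A) → ∑ (λ _ → c) xs ≡ length xs * c
  ∑-const c []       = refl
  ∑-const c (x ∷ xs) = cong (c +_) (∑-const c xs)

  ∑-++ : ∀ (f : A → ℕ) xs ys → ∑ f (xs ++ ys) ≡ ∑ f xs + ∑ f ys
  ∑-++ f []       ys = refl
  ∑-++ f (x ∷ xs) ys = trans (cong (f x +_) (∑-++ f xs ys)) (sym (+-assoc (f x) _ _))

  ∑-filterᵇ : ∀ (f : A → ℕ) p xs → ∑ f (filterᵇ p xs) ≡ ∑ (λ x → if p x then f x else 0) xs
  ∑-filterᵇ f p []       = refl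
  ∑-filterᵇ f p (x ∷ xs) with p x
  ... | true  = cong (f x +_) (∑-filterᵇ f p xs)
  ... | false = ∑-filterᵇ f p xs

  length-filterᵇ : ∀ p (xs : List A) → length (filterᵇ p xs) ≡ count p xs
  length-filterᵇ p xs = begin
    length (filterᵇ p xs)       ≡⟨ sym (*-identityʳ _) ⟩
    length (filterᵇ p xs) * 1   ≡⟨ sym (∑-const 1 (filterᵇ p xs)) ⟩
    ∑ (λ _ → 1) (filterᵇ p xs)  ≡⟨ ∑-filterᵇ (λ _ → 1) p xs ⟩
    count p xs                  ∎
    where open ≡-Reasoning

module _ {A B : Set} where

  ∑-map : ∀ (f : B → ℕ) (h : A → B) xs → ∑ f (map h xs) ≡ ∑ (λ x → f (h x)) xs
  ∑-map f h []       = refl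
  ∑-map f h (x ∷ xs) = cong (f (h x) +_) (∑-map f h xs)

  ∑-concatMap : ∀ (f : B → ℕ) (g : A → List B) xs → ∑ f (concatMap g xs) ≡ ∑ (λ x → ∑ f (g x)) xs
  ∑-concatMap f g []       = refl
  ∑-concatMap f g (x ∷ xs) = trans (∑-++ f (g x) _) (cong (∑ f (g x) +_) (∑-concatMap f g xs))

length-concatMap : ∀ {A B : Set} (g : A → List B) xs →
  length (concatMap g xs) ≡ ∑ (λ x → length (g x)) xs
length-concatMap g []       = refl
length-concatMap g (x ∷ xs) = trans (length-++ (g x)) (cong (length (g x) +_) (length-concatMap g xs))

count-all : ∀ {A : Set} (p : A → Bool) xs → (∀ {x} → x ∈ xs → p x ≡ true) → count p xs ≡ length xs
count-all p []       _   = refl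
count-all p (x ∷ xs) all rewrite all (here refl) = cong suc (count-all p xs (all ∘ there))

module _ {A : Set} (f : A → Bool) where

  any-witness : ∀ xs → any f xs ≡ true → Σ[ x ∈ A ] x ∈ xs × f x ≡ true
  any-witness xs eq with x , x∈ , fx ← find (any⁻ f xs (Equivalence.from T-≡ eq)) =
    x , x∈ , Equivalence.to T-≡ fx

  any-intro : ∀ {x xs} → x ∈ xs → f x ≡ true → any f xs ≡ true
  any-intro x∈ fx = Equivalence.to T-≡ (any⁺ f (lose x∈ (Equivalence.from T-≡ fx)))

∧-≡-true : ∀ {a b} → a ∧ b ≡ true → a ≡ true × b ≡ true
∧-≡-true {true} {true} _ = refl , refl

-- Positions and slots

-- After inserting an entry at position j, punchIn j renumbers the old positions, and collapse j
-- sends each slot of the longer list to the slot of the old list it came from (j and j + 1 both go to j).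
punchIn : ℕ → ℕ → ℕ
punchIn zero    r       = suc r
punchIn (suc j) zero    = zero
punchIn (suc j) (suc r) = suc (punchIn j r)

collapse : ℕ → ℕ → ℕ
collapse zero    zero    = zero
collapse zero    (suc y) = y
collapse (suc j) zero    = zero
collapse (suc j) (suc y) = suc (collapse j y)

punchIn-< : ∀ {j r} → r < j → punchIn j r ≡ r
punchIn-< {suc j} {zero}  _         = refl
punchIn-< {suc j} {suc r} (s≤s r<j) = cong suc (punchIn-< r<j)

punchIn-≥ : ∀ {j r} → j ≤ r → punchIn j r ≡ suc r
punchIn-≥ {zero}  {r}     _         = refl
punchIn-≥ {suc j} {suc r} (s≤s j≤r) = cong suc (punchIn-≥ j≤r)

collapse-≤ : ∀ {j y} → y ≤ j → collapse j y ≡ y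
collapse-≤ {zero}  {zero}  _         = refl
collapse-≤ {suc j} {zero}  _         = refl
collapse-≤ {suc j} {suc y} (s≤s y≤j) = cong suc (collapse-≤ y≤j)

collapse-> : ∀ {j y} → j < y → suc (collapse j y) ≡ y
collapse-> {zero}  {suc y} _         = refl
collapse-> {suc j} {suc y} (s≤s j<y) = cong suc (collapse-> j<y)

collapse-suc : ∀ j → collapse j (suc j) ≡ j
collapse-suc zero    = refl
collapse-suc (suc j) = cong suc (collapse-suc j)

collapse-punchIn : ∀ j r → collapse j (punchIn j r) ≡ r
collapse-punchIn zero    r       = refl
collapse-punchIn (suc j) zero    = refl
collapse-punchIn (suc j) (suc r) = cong suc (collapse-punchIn j r)

collapse-suc-punchIn : ∀ j r → collapse j (suc (punchIn j r)) ≡ suc r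
collapse-suc-punchIn zero    r       = refl
collapse-suc-punchIn (suc j) zero    = cong suc (collapse-≤ {j} z≤n)
collapse-suc-punchIn (suc j) (suc r) = cong suc (collapse-suc-punchIn j r)

∑-collapse : ∀ {j N} (f : ℕ → ℕ) → j < N →
  ∑ (f ∘ collapse j) (downFrom (suc N)) ≡ ∑ f (downFrom N) + f j
∑-collapse {j} {suc N} f (s≤s j≤N) with m≤n⇒m<n∨m≡n j≤N
... | inj₂ refl = begin
  f (collapse j (suc j)) + ∑ (f ∘ collapse j) (downFrom (suc j))
    ≡⟨ cong₂ _+_ (cong f (collapse-suc j))
                 (∑-cong (downFrom (suc j)) (cong f ∘ collapse-≤ ∘ ≤-pred ∘ ∈-downFrom⁻)) ⟩
  f j + ∑ f (downFrom (suc j))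
    ≡⟨ +-comm (f j) _ ⟩
  ∑ f (downFrom (suc j)) + f j ∎
  where open ≡-Reasoning
... | inj₁ j<N = begin
  f (collapse j (suc N)) + ∑ (f ∘ collapse j) (downFrom (suc N))
    ≡⟨ cong₂ _+_ (cong f (suc-injective (collapse-> (m<n⇒m<1+n j<N)))) (∑-collapse f j<N) ⟩
  f N + (∑ f (downFrom N) + f j)
    ≡⟨ sym (+-assoc (f N) _ _) ⟩
  f N + ∑ f (downFrom N) + f j ∎
  where open ≡-Reasoning

any-cong : ∀ {f g : ℕ → Bool} xs → (∀ {x} → x ∈ xs → f x ≡ g x) → any f xs ≡ any g xs
any-cong []       _  = refl
any-cong (x ∷ xs) eq = cong₂ _∨_ (eq (here refl)) (any-cong xs (eq ∘ there))

any-punchIn : ∀ {j N} (f : ℕ → Bool) → j ≤ N →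
  any f (downFrom (suc N)) ≡ f j ∨ any (f ∘ punchIn j) (downFrom N)
any-punchIn {j} {N} f j≤N with m≤n⇒m<n∨m≡n j≤N
... | inj₂ refl =
  cong (f j ∨_) (any-cong (downFrom j) (cong f ∘ sym ∘ punchIn-< ∘ ∈-downFrom⁻))
any-punchIn {j} {suc N} f _ | inj₁ (s≤s j≤N) = begin
  f (suc N) ∨ any f (downFrom (suc N))
    ≡⟨ cong (f (suc N) ∨_) (any-punchIn f j≤N) ⟩
  f (suc N) ∨ (f j ∨ rest)
    ≡⟨ ∨.x∙yz≈y∙xz (f (suc N)) (f j) rest ⟩
  f j ∨ (f (suc N) ∨ rest)
    ≡⟨ cong (λ z → f j ∨ (f z ∨ rest)) (sym (punchIn-≥ j≤N)) ⟩
  f j ∨ any (f ∘ punchIn j) (downFrom (suc N)) ∎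
  where
  open ≡-Reasoning
  rest = any (f ∘ punchIn j) (downFrom N)

count-< : ∀ {t N} → t ≤ N → count (λ y → does (y <? t)) (downFrom N) ≡ t
count-< {t} {zero}  z≤n = refl
count-< {t} {suc N} t≤1+N with m≤n⇒m<n∨m≡n t≤1+N
... | inj₁ (s≤s t≤N) rewrite dec-false (N <? t) (≤⇒≯ t≤N) = count-< t≤N
... | inj₂ refl rewrite dec-true (N <? suc N) ≤-refl =
  cong suc (trans (count-all _ (downFrom N) (dec-true (_ <? suc N) ∘ m<n⇒m<1+n ∘ ∈-downFrom⁻))
                  (length-downFrom N))

∑-shift : ∀ N (g : ℕ → ℕ) → ∑ g (downFrom (suc N)) ≡ g 0 + ∑ (g ∘ suc) (downFrom N)
∑-shift zero    g = refl
∑-shift (suc N) g = begin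
  g (suc N) + ∑ g (downFrom (suc N))             ≡⟨ cong (g (suc N) +_) (∑-shift N g) ⟩
  g (suc N) + (g 0 + ∑ (g ∘ suc) (downFrom N))   ≡⟨ +.x∙yz≈y∙xz (g (suc N)) (g 0) _ ⟩
  g 0 + (g (suc N) + ∑ (g ∘ suc) (downFrom N))   ∎
  where open ≡-Reasoning

∑-reverse : ∀ n (f : ℕ → ℕ) → ∑ (f ∘ (n ∸_)) (downFrom (suc n)) ≡ ∑ f (downFrom (suc n))
∑-reverse zero    f = refl
∑-reverse (suc n) f = trans (∑-shift (suc n) (f ∘ (suc n ∸_))) (cong (f (suc n) +_) (∑-reverse n f))

count-outside : ∀ {α β n} → α + β ≤ suc n →
  count (λ x → not (does (α ≤? x) ∧ does (β ≤? n ∸ x))) (downFrom (suc n)) ≡ α + β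
count-outside {α} {β} {n} α+β≤1+n = begin
  count (λ x → not (does (α ≤? x) ∧ does (β ≤? n ∸ x))) (downFrom (suc n))
    ≡⟨ ∑-cong (downFrom (suc n)) (split ∘ ≤-pred ∘ ∈-downFrom⁻) ⟩
  ∑ (λ x → 𝟙 (does (x <? α)) + 𝟙 (does (n ∸ x <? β))) (downFrom (suc n))
    ≡⟨ ∑-+ (λ x → 𝟙 (does (x <? α))) (λ x → 𝟙 (does (n ∸ x <? β))) (downFrom (suc n)) ⟩
  count (λ x → does (x <? α)) (downFrom (suc n)) + ∑ (λ x → 𝟙 (does (n ∸ x <? β))) (downFrom (suc n))
    ≡⟨ cong (count (λ x → does (x <? α)) (downFrom (suc n)) +_) (∑-reverse n (λ x → 𝟙 (does (x <? β)))) ⟩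
  count (λ x → does (x <? α)) (downFrom (suc n)) + count (λ x → does (x <? β)) (downFrom (suc n))
    ≡⟨ cong₂ _+_ (count-< (≤-trans (m≤m+n α β) α+β≤1+n)) (count-< (≤-trans (m≤n+m β α) α+β≤1+n)) ⟩
  α + β ∎
  where
  open ≡-Reasoning
  too-big : ∀ {x} → x ≤ n → suc x + suc (n ∸ x) ≰ suc n
  too-big {x} x≤n h =
    <-irrefl refl (subst (_≤ suc n) (cong suc (trans (+-suc x (n ∸ x)) (cong suc (m+[n∸m]≡n x≤n)))) h)
  split : ∀ {x} → x ≤ n →
    𝟙 (not (does (α ≤? x) ∧ does (β ≤? n ∸ x))) ≡ 𝟙 (does (x <? α)) + 𝟙 (does (n ∸ x <? β))
  split {x} x≤n with x <? α | n ∸ x <? β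
  ... | yes x<α | yes r<β = contradiction (≤-trans (+-mono-≤ x<α r<β) α+β≤1+n) (too-big x≤n)
  ... | yes x<α | no r≮β
    rewrite dec-false (α ≤? x) (<⇒≱ x<α) | dec-true (x <? α) x<α | dec-false (n ∸ x <? β) r≮β = refl
  ... | no x≮α  | yes r<β
    rewrite dec-true (α ≤? x) (≮⇒≥ x≮α) | dec-false (β ≤? n ∸ x) (<⇒≱ r<β)
          | dec-false (x <? α) x≮α | dec-true (n ∸ x <? β) r<β = refl
  ... | no x≮α  | no r≮β
    rewrite dec-true (α ≤? x) (≮⇒≥ x≮α) | dec-true (β ≤? n ∸ x) (≮⇒≥ r≮β)
          | dec-false (x <? α) x≮α | dec-false (n ∸ x <? β) r≮β = refl

-- Insertion and sublists

module _ {A : Set} where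

  insertAt : ℕ → A → List A → List A
  insertAt zero    x ys       = x ∷ ys
  insertAt (suc j) x []       = x ∷ []
  insertAt (suc j) x (y ∷ ys) = y ∷ insertAt j x ys

  insertAt≡take++drop : ∀ j x ys → insertAt j x ys ≡ take j ys ++ x ∷ drop j ys
  insertAt≡take++drop zero    x ys       = refl
  insertAt≡take++drop (suc j) x []       = refl
  insertAt≡take++drop (suc j) x (y ∷ ys) = cong (y ∷_) (insertAt≡take++drop j x ys)

  length-insertAt : ∀ j x ys → length (insertAt j x ys) ≡ suc (length ys)
  length-insertAt zero    x ys       = refl
  length-insertAt (suc j) x []       = refl
  length-insertAt (suc j) x (y ∷ ys) = cong suc (length-insertAt j x ys)

  ⊆-insertAt : ∀ j x ys → ys ⊆ insertAt j x ys
  ⊆-insertAt zero    x ys       = x ∷ʳ ⊆-refl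
  ⊆-insertAt (suc j) x []       = x ∷ʳ []
  ⊆-insertAt (suc j) x (y ∷ ys) = refl ∷ ⊆-insertAt j x ys

  All-insertAt : ∀ {P : A → Set} j {x ys} → P x → All P ys → All P (insertAt j x ys)
  All-insertAt zero    px pys        = px ∷ pys
  All-insertAt (suc j) px []         = px ∷ []
  All-insertAt (suc j) px (py ∷ pys) = py ∷ All-insertAt j px pys

  insertAt-↭ : ∀ j (x : A) ys → insertAt j x ys ↭ x ∷ ys
  insertAt-↭ j x ys =
    subst₂ (λ l r → l ↭ x ∷ r) (sym (insertAt≡take++drop j x ys)) (take++drop≡id j ys) (shift x (take j ys) (drop j ys))

  insertAt-length : ∀ xs (x : A) ys → insertAt (length xs) x (xs ++ ys) ≡ xs ++ x ∷ ys
  insertAt-length []       x ys = refl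
  insertAt-length (z ∷ xs) x ys = cong (z ∷_) (insertAt-length xs x ys)

  module _ (f : A → ℕ) where

    ∑-insertAt : ∀ j x ys → ∑ f (insertAt j x ys) ≡ f x + ∑ f ys
    ∑-insertAt zero    x ys       = refl
    ∑-insertAt (suc j) x []       = refl
    ∑-insertAt (suc j) x (y ∷ ys) = trans (cong (f y +_) (∑-insertAt j x ys)) (+.x∙yz≈y∙xz (f y) (f x) _)

    ∑-take-insertAt : ∀ {x} → f x ≡ 0 → ∀ j j′ ys →
      ∑ f (take j′ (insertAt j x ys)) ≡ ∑ f (take (collapse j j′) ys)
    ∑-take-insertAt fx≡0 zero    zero     ys       = refl
    ∑-take-insertAt fx≡0 zero    (suc j′) ys       = cong (_+ ∑ f (take j′ ys)) fx≡0
    ∑-take-insertAt fx≡0 (suc j) zero     ys       = refl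
    ∑-take-insertAt fx≡0 (suc j) (suc j′) []
      rewrite take-[] {A = A} j′ = cong (_+ 0) fx≡0
    ∑-take-insertAt fx≡0 (suc j) (suc j′) (y ∷ ys) = cong (f y +_) (∑-take-insertAt fx≡0 j j′ ys)

    ∑-drop-insertAt : ∀ {x} → f x ≡ 0 → ∀ j j′ ys →
      ∑ f (drop j′ (insertAt j x ys)) ≡ ∑ f (drop (collapse j j′) ys)
    ∑-drop-insertAt fx≡0 zero    zero     ys       = cong (_+ ∑ f ys) fx≡0
    ∑-drop-insertAt fx≡0 zero    (suc j′) ys       = refl
    ∑-drop-insertAt fx≡0 (suc j) zero     []       = cong (_+ 0) fx≡0
    ∑-drop-insertAt fx≡0 (suc j) (suc j′) []
      rewrite drop-[] {A = A} j′ = refl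
    ∑-drop-insertAt {x} fx≡0 (suc j) zero (y ∷ ys) =
      cong (f y +_) (trans (∑-insertAt j x ys) (cong (_+ ∑ f ys) fx≡0))
    ∑-drop-insertAt fx≡0 (suc j) (suc j′) (y ∷ ys) = ∑-drop-insertAt fx≡0 j j′ ys

-- Out-of-range positions read as 0; every use below is at a position inside the list.
nth : ℕ → List ℕ → ℕ
nth _       []       = 0
nth zero    (x ∷ xs) = x
nth (suc r) (x ∷ xs) = nth r xs

nth-insertAt : ∀ j x ys → j ≤ length ys → nth j (insertAt j x ys) ≡ x
nth-insertAt zero    x ys       _         = refl
nth-insertAt (suc j) x (y ∷ ys) (s≤s j≤n) = nth-insertAt j x ys j≤n

nth-insertAt-punchIn : ∀ j x ys r → j ≤ length ys → nth (punchIn j r) (insertAt j x ys) ≡ nth r ys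
nth-insertAt-punchIn zero    x ys       r       _         = refl
nth-insertAt-punchIn (suc j) x (y ∷ ys) zero    _         = refl
nth-insertAt-punchIn (suc j) x (y ∷ ys) (suc r) (s≤s j≤n) = nth-insertAt-punchIn j x ys r j≤n

All-nth : ∀ {P : ℕ → Set} {ys r} → All P ys → r < length ys → P (nth r ys)
All-nth {r = zero}  (py ∷ _)   _         = py
All-nth {r = suc r} (_  ∷ pys) (s≤s r<n) = All-nth pys r<n

nth-+-drop : ∀ j r ys → nth (j + r) ys ≡ nth r (drop j ys)
nth-+-drop zero    r ys       = refl
nth-+-drop (suc j) r []       = refl
nth-+-drop (suc j) r (y ∷ ys) = nth-+-drop j r ys

nth-take : ∀ {j r} ys → r < j → nth r (take j ys) ≡ nth r ys
nth-take {suc j} {r}     []       _         = refl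
nth-take {suc j} {zero}  (y ∷ ys) _         = refl
nth-take {suc j} {suc r} (y ∷ ys) (s≤s r<j) = nth-take ys r<j

below : ℕ → List ℕ → ℕ
below u = count (λ x → does (x <? u))

below-excludes : ∀ {u M} → u ≤ M → 𝟙 (does (M <? u)) ≡ 0
below-excludes u≤M = cong 𝟙 (dec-false (_ <? _) (≤⇒≯ u≤M))

below-all : ∀ {u xs} → All (_< u) xs → below u xs ≡ length xs
below-all {u} {xs} xs<u = count-all _ xs (dec-true (_ <? u) ∘ All.lookup xs<u)

below-monoˡ : ∀ {u v} xs → u ≤ v → below u xs ≤ below v xs
below-monoˡ []       u≤v = z≤n
below-monoˡ {u} {v} (x ∷ xs) u≤v with x <? u
... | yes x<u rewrite dec-true (x <? u) x<u | dec-true (x <? v) (<-≤-trans x<u u≤v) =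
  s≤s (below-monoˡ xs u≤v)
... | no  x≮u rewrite dec-false (x <? u) x≮u = ≤-trans (below-monoˡ xs u≤v) (m≤n+m _ _)

below-monoʳ : ∀ u {xs ys} → xs ⊆ ys → below u xs ≤ below u ys
below-monoʳ u []                   = z≤n
below-monoʳ u (y ∷ʳ xs⊆ys)         = ≤-trans (below-monoʳ u xs⊆ys) (m≤n+m _ _)
below-monoʳ u (_∷_ {x} refl xs⊆ys) = +-monoʳ-≤ (𝟙 (does (x <? u))) (below-monoʳ u xs⊆ys)

length≤below : ∀ {u xs ys} → All (_< u) xs → xs ⊆ ys → length xs ≤ below u ys
length≤below {u} {ys = ys} xs<u xs⊆ys = subst (_≤ below u ys) (below-all xs<u) (below-monoʳ u xs⊆ys)

sublist-below : ∀ n u zs → n ≤ below u zs → Σ[ xs ∈ List ℕ ] xs ⊆ zs × length xs ≡ n × All (_< u) xs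
sublist-below zero    u zs       _ = [] , Sublist.[]⊆-universal zs , refl , []
sublist-below (suc n) u (z ∷ zs) n≤ with z <? u
... | yes z<u rewrite dec-true (z <? u) z<u
  with xs , xs⊆zs , refl , xs<u ← sublist-below n u zs (≤-pred n≤) =
  z ∷ xs , refl ∷ xs⊆zs , refl , z<u ∷ xs<u
... | no  z≮u rewrite dec-false (z <? u) z≮u
  with xs , xs⊆zs , len , xs<u ← sublist-below (suc n) u zs n≤ =
  xs , z ∷ʳ xs⊆zs , len , xs<u

∷ʳ-⊆-take : ∀ {xs r} ys → xs ⊆ take r ys → r < length ys → xs ++ [ nth r ys ] ⊆ take (suc r) ys
∷ʳ-⊆-take {[]}     {zero}  (y ∷ ys) []             _         = refl ∷ Sublist.[]⊆-universal _
∷ʳ-⊆-take {xs}     {suc r} (y ∷ ys) (.y ∷ʳ xs⊆)    (s≤s r<n) = y ∷ʳ ∷ʳ-⊆-take ys xs⊆ r<n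
∷ʳ-⊆-take {x ∷ xs} {suc r} (y ∷ ys) (refl ∷ xs⊆)   (s≤s r<n) = refl ∷ ∷ʳ-⊆-take ys xs⊆ r<n

∷-⊆-drop : ∀ {xs r} ys → xs ⊆ drop (suc r) ys → r < length ys → nth r ys ∷ xs ⊆ drop r ys
∷-⊆-drop {r = zero}  (y ∷ ys) xs⊆ _         = refl ∷ xs⊆
∷-⊆-drop {r = suc r} (y ∷ ys) xs⊆ (s≤s r<n) = ∷-⊆-drop ys xs⊆ r<n

first-position : ∀ {q xs} zs → q ∷ xs ⊆ zs →
  Σ[ r ∈ ℕ ] r < length zs × nth r zs ≡ q × xs ⊆ drop (suc r) zs
first-position (z ∷ zs) (.z ∷ʳ q∷xs⊆) with r , r<n , eq , xs⊆ ← first-position zs q∷xs⊆ =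
  suc r , s≤s r<n , eq , xs⊆
first-position (z ∷ zs) (refl ∷ xs⊆)  = zero , s≤s z≤n , refl , xs⊆

last-position : ∀ {p} xs zs → xs ++ [ p ] ⊆ zs →
  Σ[ r ∈ ℕ ] r < length zs × nth r zs ≡ p × xs ⊆ take r zs
last-position []       (z ∷ zs) (refl ∷ _)  = zero , s≤s z≤n , refl , []
last-position xs       (z ∷ zs) (.z ∷ʳ xs⊆) with r , r<n , eq , xs⊆′ ← last-position xs zs xs⊆ =
  suc r , s≤s r<n , eq , z ∷ʳ xs⊆′
last-position (x ∷ xs) (z ∷ zs) (refl ∷ xs⊆) with r , r<n , eq , xs⊆′ ← last-position xs zs xs⊆ =
  suc r , s≤s r<n , eq , refl ∷ xs⊆′

⊆-++-∷ : ∀ {A : Set} {m : A} {s} as bs → s ⊆ as ++ m ∷ bs →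
  s ⊆ as ++ bs ⊎ ∃₂ λ s₁ s₂ → s ≡ s₁ ++ m ∷ s₂ × s₁ ⊆ as × s₂ ⊆ bs
⊆-++-∷ []       bs (_ ∷ʳ s⊆)   = inj₁ s⊆
⊆-++-∷ []       bs (_∷_ {xs = s₂} refl s⊆) = inj₂ ([] , s₂ , refl , [] , s⊆)
⊆-++-∷ (a ∷ as) bs (.a ∷ʳ s⊆) with ⊆-++-∷ as bs s⊆
... | inj₁ s⊆′                          = inj₁ (a ∷ʳ s⊆′)
... | inj₂ (s₁ , s₂ , refl , s₁⊆ , s₂⊆) = inj₂ (s₁ , s₂ , refl , a ∷ʳ s₁⊆ , s₂⊆)
⊆-++-∷ (a ∷ as) bs (refl ∷ s⊆) with ⊆-++-∷ as bs s⊆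
... | inj₁ s⊆′                          = inj₁ (refl ∷ s⊆′)
... | inj₂ (s₁ , s₂ , refl , s₁⊆ , s₂⊆) = inj₂ (a ∷ s₁ , s₂ , refl , refl ∷ s₁⊆ , s₂⊆)

split-around-two : ∀ {A : Set} n {m} (s : List A) → length s ≡ n + (2 + m) →
  Σ[ xs ∈ List A ] Σ[ p ∈ A ] Σ[ q ∈ A ] Σ[ ys ∈ List A ]
    s ≡ xs ++ p ∷ q ∷ ys × length xs ≡ n × length ys ≡ m
split-around-two zero    (p ∷ q ∷ ys) eq = [] , p , q , ys , refl , refl , suc-injective (suc-injective eq)
split-around-two (suc n) (x ∷ s)      eq
  with xs , p , q , ys , refl , |xs| , |ys| ← split-around-two n s (suc-injective eq) =
  x ∷ xs , p , q , ys , refl , cong suc |xs| , |ys|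

locate-top : ∀ {m p q} xs ys s₁ s₂ → xs ++ p ∷ q ∷ ys ≡ s₁ ++ m ∷ s₂ → All (_< m) xs → All (_< m) ys →
  (m ≡ p × s₁ ≡ xs × s₂ ≡ q ∷ ys) ⊎ (m ≡ q × s₁ ≡ xs ++ [ p ] × s₂ ≡ ys)
locate-top []       ys []             s₂ refl _         _    = inj₁ (refl , refl , refl)
locate-top []       ys (_ ∷ [])       s₂ refl _         _    = inj₂ (refl , refl , refl)
locate-top []       ys (_ ∷ _ ∷ s₁)   s₂ refl _         ys<m =
  contradiction (All.lookup ys<m (∈-++⁺ʳ s₁ (here refl))) (<-irrefl refl)
locate-top (x ∷ xs) ys []             s₂ refl (x<m ∷ _) _    = contradiction x<m (<-irrefl refl)
locate-top (x ∷ xs) ys (_ ∷ s₁)       s₂ eq   (_ ∷ xs<m) ys<m with refl , eq′ ← ∷-injective eq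
  with locate-top xs ys s₁ s₂ eq′ xs<m ys<m
... | inj₁ (m≡p , refl , s₂≡) = inj₁ (m≡p , refl , s₂≡)
... | inj₂ (m≡q , refl , s₂≡) = inj₂ (m≡q , refl , s₂≡)

lookup-top₁ : ∀ {A : Set} (xs : List A) p q ys (t : Fin (length (xs ++ p ∷ q ∷ ys))) →
  toℕ t ≡ length xs → lookup (xs ++ p ∷ q ∷ ys) t ≡ p
lookup-top₁ []       p q ys zero    _  = refl
lookup-top₁ (x ∷ xs) p q ys (suc t) eq = lookup-top₁ xs p q ys t (suc-injective eq)

lookup-top₂ : ∀ {A : Set} (xs : List A) p q ys (t : Fin (length (xs ++ p ∷ q ∷ ys))) →
  toℕ t ≡ suc (length xs) → lookup (xs ++ p ∷ q ∷ ys) t ≡ q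
lookup-top₂ []       p q ys (suc zero) _  = refl
lookup-top₂ (x ∷ xs) p q ys (suc t)    eq = lookup-top₂ xs p q ys t (suc-injective eq)

lookup-outer : ∀ {A : Set} (xs : List A) p q ys (t : Fin (length (xs ++ p ∷ q ∷ ys))) →
  toℕ t ≢ length xs → toℕ t ≢ suc (length xs) → lookup (xs ++ p ∷ q ∷ ys) t ∈ xs ++ ys
lookup-outer []       p q ys zero          ≢top₁ _     = contradiction refl ≢top₁
lookup-outer []       p q ys (suc zero)    _     ≢top₂ = contradiction refl ≢top₂
lookup-outer []       p q ys (suc (suc t)) _     _     = ∈-lookup t
lookup-outer (x ∷ xs) p q ys zero          _     _     = here refl
lookup-outer (x ∷ xs) p q ys (suc t)       ≢top₁ ≢top₂ =
  there (lookup-outer xs p q ys t (≢top₁ ∘ cong suc) (≢top₂ ∘ cong suc))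

index-top₁ : ∀ {A : Set} (xs : List A) p q ys → Σ[ t ∈ Fin (length (xs ++ p ∷ q ∷ ys)) ] toℕ t ≡ length xs
index-top₁ []       p q ys = zero , refl
index-top₁ (x ∷ xs) p q ys with t , eq ← index-top₁ xs p q ys = suc t , cong suc eq

index-top₂ : ∀ {A : Set} (xs : List A) p q ys → Σ[ t ∈ Fin (length (xs ++ p ∷ q ∷ ys)) ] toℕ t ≡ suc (length xs)
index-top₂ []       p q ys = suc zero , refl
index-top₂ (x ∷ xs) p q ys with t , eq ← index-top₂ xs p q ys = suc t , cong suc eq

index-outer : ∀ {A : Set} (xs : List A) p q ys {z} → z ∈ xs ++ ys →
  Σ[ t ∈ Fin (length (xs ++ p ∷ q ∷ ys)) ]
    toℕ t ≢ length xs × toℕ t ≢ suc (length xs) × lookup (xs ++ p ∷ q ∷ ys) t ≡ z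
index-outer []       p q ys z∈ys        = suc (suc (Any.index z∈ys)) , (λ ()) , (λ ()) , sym (lookup-index z∈ys)
index-outer (x ∷ xs) p q ys (here refl) = zero , (λ ()) , (λ ()) , refl
index-outer (x ∷ xs) p q ys (there z∈)  with t , ≢top₁ , ≢top₂ , eq ← index-outer xs p q ys z∈ =
  suc t , ≢top₁ ∘ suc-injective , ≢top₂ ∘ suc-injective , eq

-- Duplicate-free enumerations

Unique-map⁺-on : ∀ {A B : Set} (f : A → B) {xs} → Unique xs →
  (∀ {a b} → a ∈ xs → b ∈ xs → f a ≡ f b → a ≡ b) → Unique (map f xs)
Unique-map⁺-on f {[]}     []          _         = []
Unique-map⁺-on f {x ∷ xs} (x∉xs ∷ xs!) injective =
  All.tabulate fresh ∷ Unique-map⁺-on f xs! (λ a∈ b∈ → injective (there a∈) (there b∈))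
  where
  fresh : ∀ {w} → w ∈ map f xs → f x ≢ w
  fresh w∈ eq with y , y∈ , refl ← ∈-map⁻ f w∈ = All.lookup x∉xs y∈ (injective (here refl) (there y∈) eq)

module _ {A B C : Set} (h : A → B → C) (s : A → List B) where

  ∈-concatMap-map⁻ : ∀ {w xs} → w ∈ concatMap (λ x → map (h x) (s x)) xs →
    ∃₂ λ x b → x ∈ xs × b ∈ s x × w ≡ h x b
  ∈-concatMap-map⁻ w∈ with x , x∈ , w∈′ ← find (∈-concatMap⁻ (λ x → map (h x) (s x)) w∈)
    with b , b∈ , refl ← ∈-map⁻ (h x) w∈′ = x , b , x∈ , b∈ , refl

  ∈-concatMap-map⁺ : ∀ {x b xs} → x ∈ xs → b ∈ s x → h x b ∈ concatMap (λ x → map (h x) (s x)) xs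
  ∈-concatMap-map⁺ x∈ b∈ = ∈-concatMap⁺ (λ x → map (h x) (s x)) (lose x∈ (∈-map⁺ (h _) b∈))

  Unique-concatMap-map : ∀ {xs} → Unique xs → (∀ {x} → x ∈ xs → Unique (s x)) →
    (∀ {x x′ b b′} → x ∈ xs → x′ ∈ xs → b ∈ s x → b′ ∈ s x′ → h x b ≡ h x′ b′ → x ≡ x′ × b ≡ b′) →
    Unique (concatMap (λ x → map (h x) (s x)) xs)
  Unique-concatMap-map {[]}     []           _        _         = []
  Unique-concatMap-map {x ∷ xs} (x∉xs ∷ xs!) s-unique injective =
    Unique.++⁺ map-unique
      (Unique-concatMap-map xs! (s-unique ∘ there) (λ x∈ x′∈ → injective (there x∈) (there x′∈)))
      disjoint
    where
    map-unique : Unique (map (h x) (s x))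
    map-unique = Unique-map⁺-on (h x) (s-unique (here refl))
      (λ b∈ b′∈ → proj₂ ∘ injective (here refl) (here refl) b∈ b′∈)
    disjoint : ∀ {w} → ¬ (w ∈ map (h x) (s x) × w ∈ concatMap (λ x → map (h x) (s x)) xs)
    disjoint (w∈ , w∈′) with b , b∈ , refl ← ∈-map⁻ (h x) w∈
      with x′ , b′ , x′∈ , b′∈ , eq ← ∈-concatMap-map⁻ w∈′ =
      All.lookup x∉xs x′∈ (proj₁ (injective (here refl) (there x′∈) b∈ b′∈ eq))

-- Permutations

IsPermOf-All : ∀ {n σ} → IsPermOf n σ → All (_< suc n) σ
IsPermOf-All σ↭ = All.tabulate λ x∈ → bounded (∈-applyUpTo⁻ suc (∈-resp-↭ σ↭ x∈))
  where
  bounded : ∀ {n v} → Σ[ i ∈ ℕ ] i < n × v ≡ suc i → v < suc n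
  bounded (i , i<n , refl) = s≤s i<n

IsPermOf-length : ∀ {n σ} → IsPermOf n σ → length σ ≡ n
IsPermOf-length {n} σ↭ = trans (↭-length σ↭) (length-applyUpTo suc n)

private
  upTo-suc : ∀ n → applyUpTo suc (suc n) ↭ suc n ∷ applyUpTo suc n
  upTo-suc n =
    subst (_↭ suc n ∷ applyUpTo suc n) (applyUpTo-∷ʳ suc n) (↭-sym (∷↭∷ʳ (suc n) (applyUpTo suc n)))

IsPermOf-insertAt : ∀ {n σ} j → IsPermOf n σ → IsPermOf (suc n) (insertAt j (suc n) σ)
IsPermOf-insertAt {n} {σ} j σ↭ =
  ↭-trans (insertAt-↭ j (suc n) σ) (↭-trans (prep (suc n) σ↭) (↭-sym (upTo-suc n)))

IsPermOf-remove-max : ∀ {n w} → IsPermOf (suc n) w →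
  Σ[ j ∈ ℕ ] Σ[ σ ∈ List ℕ ] j ≤ n × IsPermOf n σ × w ≡ insertAt j (suc n) σ
IsPermOf-remove-max {n} {w} w↭
  with xs , ys , refl ← ∈-∃++ (∈-resp-↭ (↭-sym w↭) (∈-applyUpTo⁺ suc {n} {suc n} ≤-refl)) =
  length xs , xs ++ ys , j≤n , σ↭ , sym (insertAt-length xs (suc n) ys)
  where
  σ↭ : IsPermOf n (xs ++ ys)
  σ↭ = drop-∷ (↭-trans (↭-sym (shift (suc n) xs ys)) (↭-trans w↭ (upTo-suc n)))
  j≤n : length xs ≤ n
  j≤n = subst (length xs ≤_) (trans (sym (length-++ xs)) (IsPermOf-length σ↭))
              (m≤m+n (length xs) (length ys))

insertAt-injective : ∀ {M j j′ σ σ′} → All (_< M) σ → All (_< M) σ′ → j ≤ length σ → j′ ≤ length σ′ →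
  insertAt j M σ ≡ insertAt j′ M σ′ → j ≡ j′ × σ ≡ σ′
insertAt-injective {j = zero}  {zero}   _ _ _ _ eq = refl , proj₂ (∷-injective eq)
insertAt-injective {j = zero}  {suc j′} {σ′ = y ∷ _} _ (y<M ∷ _) _ (s≤s _) eq =
  contradiction y<M (<-irrefl (sym (proj₁ (∷-injective eq))))
insertAt-injective {j = suc j} {zero}   {σ = y ∷ _} (y<M ∷ _) _ (s≤s _) _ eq =
  contradiction y<M (<-irrefl (proj₁ (∷-injective eq)))
insertAt-injective {j = suc j} {suc j′} {_ ∷ σ} {_ ∷ σ′} (_ ∷ σ<M) (_ ∷ σ′<M) (s≤s j≤n) (s≤s j′≤n) eq
  with refl , eq′ ← ∷-injective eq
  with refl , refl ← insertAt-injective σ<M σ′<M j≤n j′≤n eq′ = refl , refl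

cancel-recurrence : ∀ c X Y N → X + N * (c * c) ≡ c * (Y + N) + c * Y → X + c * (c ∸ 1) * N ≡ 2 * c * Y
cancel-recurrence zero    X Y N eq = trans (cong (X +_) (sym (*-zeroʳ N))) eq
cancel-recurrence (suc d) X Y N eq = +-cancelʳ-≡ (suc d * N) _ _ (begin
  X + suc d * d * N + suc d * N    ≡⟨ regroup X d N ⟩
  X + N * (suc d * suc d)          ≡⟨ eq ⟩
  suc d * (Y + N) + suc d * Y      ≡⟨ collect d Y N ⟩
  2 * suc d * Y + suc d * N        ∎)
  where
  open ≡-Reasoning
  regroup : ∀ X d N → X + suc d * d * N + suc d * N ≡ X + N * (suc d * suc d)
  regroup = solve-∀
  collect : ∀ d Y N → suc d * (Y + N) + suc d * Y ≡ 2 * suc d * Y + suc d * N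
  collect = solve-∀

-- The pattern ({i, i+1} / [k] ∖ {i, i+1}) with α = i - 1 and β = k - i - 1.
module Pattern (α β : ℕ) where

  record Occurrence (w : List ℕ) : Set where
    constructor occurrence
    field
      left        : List ℕ
      top₁ top₂   : ℕ
      right       : List ℕ
      embeds      : left ++ top₁ ∷ top₂ ∷ right ⊆ w
      left-length  : length left ≡ α
      right-length : length right ≡ β
      below-top₁  : All (_< top₁) (left ++ right)
      below-top₂  : All (_< top₂) (left ++ right)

  private
    Top : ℕ → Set
    Top = Pair (suc α)

    Top⇒≡ : ∀ (xs : List ℕ) {t} → length xs ≡ α → Top (suc t) → t ≡ length xs ⊎ t ≡ suc (length xs)
    Top⇒≡ xs |xs| (inj₁ eq) = inj₁ (trans (suc-injective eq) (sym |xs|))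
    Top⇒≡ xs |xs| (inj₂ eq) = inj₂ (trans (suc-injective eq) (cong suc (sym |xs|)))

    ≡⇒Top : ∀ (xs : List ℕ) {t} → length xs ≡ α → t ≡ length xs ⊎ t ≡ suc (length xs) → Top (suc t)
    ≡⇒Top xs |xs| (inj₁ eq) = inj₁ (cong suc (trans eq |xs|))
    ≡⇒Top xs |xs| (inj₂ eq) = inj₂ (cong suc (trans eq (cong suc |xs|)))

  α+[2+β] : α + (2 + β) ≡ 2 + α + β
  α+[2+β] = trans (+-suc α (suc β)) (cong suc (+-suc α β))

  occurrence⇒OccursCBP : ∀ {w} → Occurrence w → OccursCBP (2 + α + β) (Pair (suc α)) w
  occurrence⇒OccursCBP (occurrence xs p q ys embeds |xs| |ys| <p <q) =
    xs ++ p ∷ q ∷ ys , embeds , length-occurrence , larger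
    where
    length-occurrence : length (xs ++ p ∷ q ∷ ys) ≡ 2 + α + β
    length-occurrence = begin
      length (xs ++ p ∷ q ∷ ys)         ≡⟨ length-++ xs ⟩
      length xs + (2 + length ys)       ≡⟨ cong₂ (λ m n → m + (2 + n)) |xs| |ys| ⟩
      α + (2 + β)                       ≡⟨ α+[2+β] ⟩
      2 + α + β                         ∎
      where open ≡-Reasoning
    s = xs ++ p ∷ q ∷ ys
    outer : ∀ b → ¬ Top (suc (toℕ b)) → lookup s b ∈ xs ++ ys
    outer b outer-b =
      lookup-outer xs p q ys b (outer-b ∘ ≡⇒Top xs |xs| ∘ inj₁) (outer-b ∘ ≡⇒Top xs |xs| ∘ inj₂)
    larger : ∀ a b → Top (suc (toℕ a)) → ¬ Top (suc (toℕ b)) → lookup s b < lookup s a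
    larger a b top-a outer-b with Top⇒≡ xs |xs| top-a
    ... | inj₁ a≡ = subst (lookup s b <_) (sym (lookup-top₁ xs p q ys a a≡)) (All.lookup <p (outer b outer-b))
    ... | inj₂ a≡ = subst (lookup s b <_) (sym (lookup-top₂ xs p q ys a a≡)) (All.lookup <q (outer b outer-b))

  OccursCBP⇒occurrence : ∀ {w} → OccursCBP (2 + α + β) (Pair (suc α)) w → Occurrence w
  OccursCBP⇒occurrence (s , embeds , |s| , larger) with split-around-two α s (trans |s| (sym α+[2+β]))
  ... | xs , p , q , ys , refl , |xs| , |ys| =
    occurrence xs p q ys embeds |xs| |ys|
      (dominates top₁ (lookup-top₁ xs p q ys top₁ eq₁) (≡⇒Top xs |xs| (inj₁ eq₁)))
      (dominates top₂ (lookup-top₂ xs p q ys top₂ eq₂) (≡⇒Top xs |xs| (inj₂ eq₂)))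
    where
    s′ = xs ++ p ∷ q ∷ ys
    top₁ = proj₁ (index-top₁ xs p q ys)
    eq₁ = proj₂ (index-top₁ xs p q ys)
    top₂ = proj₁ (index-top₂ xs p q ys)
    eq₂ = proj₂ (index-top₂ xs p q ys)
    dominates : ∀ {v} t → lookup s′ t ≡ v → Top (suc (toℕ t)) → All (_< v) (xs ++ ys)
    dominates t eq top = All.tabulate λ z∈ →
      let t′ , ≢₁ , ≢₂ , eq′ = index-outer xs p q ys z∈
      in subst₂ _<_ eq′ eq (larger t t′ top ([ ≢₁ , ≢₂ ]′ ∘ Top⇒≡ xs |xs|))

  <⇒≤-All : ∀ {M σ} → All (_< M) σ → All (_≤ M) σ
  <⇒≤-All = All.map <⇒≤

  flanked : ℕ → List ℕ → List ℕ → Bool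
  flanked u xs ys = does (α ≤? below u xs) ∧ does (β ≤? below u ys)

  slotFlanked : List ℕ → ℕ → ℕ → Bool
  slotFlanked σ u x = flanked u (take x σ) (drop x σ)

  deep : List ℕ → ℕ → Bool
  deep σ r = flanked (nth r σ) (take r σ) (drop (suc r) σ)

  -- Inserting a new maximum at slot x creates an occurrence whose other large entry sits at position r.
  blocks : List ℕ → ℕ → ℕ → Bool
  blocks σ x r = deep σ r ∧ slotFlanked σ (nth r σ) x

  blocked : List ℕ → ℕ → Bool
  blocked σ x = any (blocks σ x) (downFrom (length σ))

  flanked-insertAt : ∀ {u M} → u ≤ M → ∀ j j₁ j₂ σ →
    flanked u (take j₁ (insertAt j M σ)) (drop j₂ (insertAt j M σ))
      ≡ flanked u (take (collapse j j₁) σ) (drop (collapse j j₂) σ)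
  flanked-insertAt {u} u≤M j j₁ j₂ σ = cong₂ (λ a b → does (α ≤? a) ∧ does (β ≤? b))
    (∑-take-insertAt (λ x → 𝟙 (does (x <? u))) (below-excludes u≤M) j j₁ σ)
    (∑-drop-insertAt (λ x → 𝟙 (does (x <? u))) (below-excludes u≤M) j j₂ σ)

  blocked-insertAt : ∀ {M σ} j y → All (_≤ M) σ → j ≤ length σ →
    blocked (insertAt j M σ) y ≡ (slotFlanked σ M j ∧ slotFlanked σ M (collapse j y)) ∨ blocked σ (collapse j y)
  blocked-insertAt {M} {σ} j y σ≤M j≤n = begin
    any (blocks σ′ y) (downFrom (length σ′))
      ≡⟨ cong (any (blocks σ′ y) ∘ downFrom) (length-insertAt j M σ) ⟩
    any (blocks σ′ y) (downFrom (suc (length σ)))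
      ≡⟨ any-punchIn (blocks σ′ y) j≤n ⟩
    blocks σ′ y j ∨ any (blocks σ′ y ∘ punchIn j) (downFrom (length σ))
      ≡⟨ cong₂ _∨_ new-entry (any-cong (downFrom (length σ)) (old-entry ∘ ∈-downFrom⁻)) ⟩
    (slotFlanked σ M j ∧ slotFlanked σ M (collapse j y)) ∨ blocked σ (collapse j y) ∎
    where
    open ≡-Reasoning
    σ′ = insertAt j M σ
    both : ℕ → List ℕ → ℕ → ℕ → ℕ → Bool
    both u τ r₁ r₂ x = flanked u (take r₁ τ) (drop r₂ τ) ∧ slotFlanked τ u x
    both-insertAt : ∀ {u} → u ≤ M → ∀ r₁ r₂ →
      both u σ′ r₁ r₂ y ≡ both u σ (collapse j r₁) (collapse j r₂) (collapse j y)
    both-insertAt u≤M r₁ r₂ = cong₂ _∧_ (flanked-insertAt u≤M j r₁ r₂ σ) (flanked-insertAt u≤M j y y σ)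
    new-entry : blocks σ′ y j ≡ slotFlanked σ M j ∧ slotFlanked σ M (collapse j y)
    new-entry = begin
      both (nth j σ′) σ′ j (suc j) y
        ≡⟨ cong (λ u → both u σ′ j (suc j) y) (nth-insertAt j M σ j≤n) ⟩
      both M σ′ j (suc j) y
        ≡⟨ both-insertAt ≤-refl j (suc j) ⟩
      both M σ (collapse j j) (collapse j (suc j)) (collapse j y)
        ≡⟨ cong₂ (λ r₁ r₂ → both M σ r₁ r₂ (collapse j y)) (collapse-≤ {j} ≤-refl) (collapse-suc j) ⟩
      both M σ j j (collapse j y) ∎
    old-entry : ∀ {r} → r < length σ → blocks σ′ y (punchIn j r) ≡ blocks σ (collapse j y) r
    old-entry {r} r<n = begin
      both (nth (punchIn j r) σ′) σ′ (punchIn j r) (suc (punchIn j r)) y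
        ≡⟨ cong (λ u → both u σ′ (punchIn j r) (suc (punchIn j r)) y) (nth-insertAt-punchIn j M σ r j≤n) ⟩
      both (nth r σ) σ′ (punchIn j r) (suc (punchIn j r)) y
        ≡⟨ both-insertAt (All-nth σ≤M r<n) (punchIn j r) (suc (punchIn j r)) ⟩
      both (nth r σ) σ (collapse j (punchIn j r)) (collapse j (suc (punchIn j r))) (collapse j y)
        ≡⟨ cong₂ (λ r₁ r₂ → both (nth r σ) σ r₁ r₂ (collapse j y))
                 (collapse-punchIn j r) (collapse-suc-punchIn j r) ⟩
      both (nth r σ) σ r (suc r) (collapse j y) ∎

  flanked-monoˡ : ∀ {u v} xs ys → u ≤ v → flanked u xs ys ≡ true → flanked v xs ys ≡ true
  flanked-monoˡ {u} {v} xs ys u≤v eq with e₁ , e₂ ← ∧-≡-true {does (α ≤? below u xs)} eq =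
    cong₂ _∧_ (raise {α} xs e₁) (raise {β} ys e₂)
    where
    raise : ∀ {m} zs → does (m ≤? below u zs) ≡ true → does (m ≤? below v zs) ≡ true
    raise {m} zs e = dec-true (m ≤? _) (≤-trans (≤ᵇ⇒≤ m _ (Equivalence.from T-≡ e)) (below-monoˡ zs u≤v))

  slotFlanked-max : ∀ {M σ x} → All (_< M) σ → x ≤ length σ →
    slotFlanked σ M x ≡ does (α ≤? x) ∧ does (β ≤? length σ ∸ x)
  slotFlanked-max {M} {σ} {x} σ<M x≤n = cong₂ (λ a b → does (α ≤? a) ∧ does (β ≤? b))
    (trans (below-all (Allₚ.take⁺ x σ<M)) (trans (length-take x σ) (m≤n⇒m⊓n≡m x≤n)))
    (trans (below-all (Allₚ.drop⁺ x σ<M)) (length-drop x σ))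

  blocked⇒slotFlanked : ∀ {M σ} x → All (_≤ M) σ → blocked σ x ≡ true → slotFlanked σ M x ≡ true
  blocked⇒slotFlanked {M} {σ} x σ≤M eq with r , r∈ , blocks-r ← any-witness (blocks σ x) _ eq =
    flanked-monoˡ (take x σ) (drop x σ) (All-nth σ≤M (∈-downFrom⁻ r∈))
      (proj₂ (∧-≡-true {deep σ r} blocks-r))

  slots : List ℕ → List ℕ
  slots σ = downFrom (suc (length σ))

  freeCount : List ℕ → ℕ
  freeCount σ = count (not ∘ blocked σ) (slots σ)

  unblocked-if-unflanked : ∀ {M σ} x → All (_≤ M) σ → slotFlanked σ M x ≡ false → blocked σ x ≡ false
  unblocked-if-unflanked {M} {σ} x σ≤M unflanked with blocked σ x in eq
  ... | false = refl
  ... | true  = contradiction (trans (sym (blocked⇒slotFlanked x σ≤M eq)) unflanked) λ ()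

  unflanked-count : ∀ {M σ} → All (_< M) σ → α + β ≤ suc (length σ) →
    count (not ∘ slotFlanked σ M) (slots σ) ≡ α + β
  unflanked-count {M} {σ} σ<M α+β≤ = trans
    (∑-cong (slots σ) (cong (𝟙 ∘ not) ∘ slotFlanked-max σ<M ∘ ≤-pred ∘ ∈-downFrom⁻))
    (count-outside {α} {β} α+β≤)

  survives : List ℕ → ℕ → ℕ → ℕ → Bool
  survives σ M j y = not ((slotFlanked σ M j ∧ slotFlanked σ M y) ∨ blocked σ y)

  freeCount-insertAt : ∀ {M σ} j → All (_≤ M) σ → j ≤ length σ →
    freeCount (insertAt j M σ) ≡ count (survives σ M j) (slots σ) + 𝟙 (survives σ M j j)
  freeCount-insertAt {M} {σ} j σ≤M j≤n = begin
    count (not ∘ blocked σ′) (downFrom (suc (length σ′)))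
      ≡⟨ cong (count (not ∘ blocked σ′) ∘ downFrom ∘ suc) (length-insertAt j M σ) ⟩
    count (not ∘ blocked σ′) (downFrom (suc (suc (length σ))))
      ≡⟨ ∑-cong (downFrom (suc (suc (length σ)))) (λ {y} _ → cong (𝟙 ∘ not) (blocked-insertAt j y σ≤M j≤n)) ⟩
    ∑ (𝟙 ∘ survives σ M j ∘ collapse j) (downFrom (suc (suc (length σ))))
      ≡⟨ ∑-collapse (𝟙 ∘ survives σ M j) (s≤s j≤n) ⟩
    count (survives σ M j) (slots σ) + 𝟙 (survives σ M j j) ∎
    where
    open ≡-Reasoning
    σ′ = insertAt j M σ

  freeCount-insertAt-unflanked : ∀ {M σ} j → All (_≤ M) σ → j ≤ length σ → slotFlanked σ M j ≡ false →
    freeCount (insertAt j M σ) ≡ suc (freeCount σ)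
  freeCount-insertAt-unflanked {M} {σ} j σ≤M j≤n j-unflanked = begin
    freeCount (insertAt j M σ)
      ≡⟨ freeCount-insertAt j σ≤M j≤n ⟩
    count (survives σ M j) (slots σ) + 𝟙 (survives σ M j j)
      ≡⟨ cong₂ _+_ (∑-cong (slots σ) (λ {y} _ → cong 𝟙 (survives≡ y))) (cong 𝟙 (survives≡ j)) ⟩
    freeCount σ + 𝟙 (not (blocked σ j))
      ≡⟨ cong (λ b → freeCount σ + 𝟙 (not b)) (unblocked-if-unflanked j σ≤M j-unflanked) ⟩
    freeCount σ + 1
      ≡⟨ +-comm (freeCount σ) 1 ⟩
    suc (freeCount σ) ∎
    where
    open ≡-Reasoning
    survives≡ : ∀ y → survives σ M j y ≡ not (blocked σ y)
    survives≡ y = cong (λ b → not ((b ∧ slotFlanked σ M y) ∨ blocked σ y)) j-unflanked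

  freeCount-insertAt-flanked : ∀ {M σ} j → All (_< M) σ → j ≤ length σ → slotFlanked σ M j ≡ true →
    α + β ≤ suc (length σ) → freeCount (insertAt j M σ) ≡ α + β
  freeCount-insertAt-flanked {M} {σ} j σ<M j≤n j-flanked α+β≤ = begin
    freeCount (insertAt j M σ)
      ≡⟨ freeCount-insertAt j σ≤M j≤n ⟩
    count (survives σ M j) (slots σ) + 𝟙 (survives σ M j j)
      ≡⟨ cong₂ _+_ (∑-cong (slots σ) (λ {y} _ → cong 𝟙 (survives≡ y))) (cong 𝟙 (survives≡ j)) ⟩
    count (not ∘ slotFlanked σ M) (slots σ) + 𝟙 (not (slotFlanked σ M j))
      ≡⟨ cong₂ _+_ (unflanked-count σ<M α+β≤) (cong (𝟙 ∘ not) j-flanked) ⟩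
    α + β + 0
      ≡⟨ +-identityʳ (α + β) ⟩
    α + β ∎
    where
    open ≡-Reasoning
    σ≤M = <⇒≤-All σ<M
    survives≡ : ∀ y → survives σ M j y ≡ not (slotFlanked σ M y)
    survives≡ y rewrite j-flanked with slotFlanked σ M y in e
    ... | true  = refl
    ... | false rewrite unblocked-if-unflanked y σ≤M e = refl

  freeCount-split : ∀ {M σ} → All (_< M) σ → α + β ≤ suc (length σ) →
    freeCount σ ≡ α + β + count (λ x → slotFlanked σ M x ∧ not (blocked σ x)) (slots σ)
  freeCount-split {M} {σ} σ<M α+β≤ = begin
    freeCount σ
      ≡⟨ ∑-cong (slots σ) (λ {x} _ → split x) ⟩
    ∑ (λ x → 𝟙 (not (slotFlanked σ M x)) + 𝟙 (slotFlanked σ M x ∧ not (blocked σ x))) (slots σ)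
      ≡⟨ ∑-+ (𝟙 ∘ not ∘ slotFlanked σ M) _ (slots σ) ⟩
    count (not ∘ slotFlanked σ M) (slots σ) + m
      ≡⟨ cong (_+ m) (unflanked-count σ<M α+β≤) ⟩
    α + β + m ∎
    where
    open ≡-Reasoning
    m = count (λ x → slotFlanked σ M x ∧ not (blocked σ x)) (slots σ)
    split : ∀ x →
      𝟙 (not (blocked σ x)) ≡ 𝟙 (not (slotFlanked σ M x)) + 𝟙 (slotFlanked σ M x ∧ not (blocked σ x))
    split x with slotFlanked σ M x in e
    ... | true  = refl
    ... | false rewrite unblocked-if-unflanked x (<⇒≤-All σ<M) e = refl

  freeCount-child : ∀ {M σ x} → All (_< M) σ → α + β ≤ suc (length σ) → x ≤ length σ →
    (if not (blocked σ x) then freeCount (insertAt x M σ) else 0)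
      ≡ suc (freeCount σ) * 𝟙 (not (slotFlanked σ M x)) + (α + β) * 𝟙 (slotFlanked σ M x ∧ not (blocked σ x))
  freeCount-child {M} {σ} {x} σ<M α+β≤ x≤n with slotFlanked σ M x in e | blocked σ x in b
  ... | false | true  = contradiction (trans (sym b) (unblocked-if-unflanked x (<⇒≤-All σ<M) e)) λ ()
  ... | false | false =
    trans (freeCount-insertAt-unflanked x (<⇒≤-All σ<M) x≤n e)
          (sym (trans (cong₂ _+_ (*-identityʳ (suc (freeCount σ))) (*-zeroʳ (α + β))) (+-identityʳ _)))
  ... | true  | true  = sym (cong₂ _+_ (*-zeroʳ (suc (freeCount σ))) (*-zeroʳ (α + β)))
  ... | true  | false =
    trans (freeCount-insertAt-flanked x σ<M x≤n e α+β≤)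
          (sym (cong₂ _+_ (*-zeroʳ (suc (freeCount σ))) (*-identityʳ (α + β))))

  ∑-freeCount-insertAt : ∀ {M σ} → All (_< M) σ → α + β ≤ suc (length σ) →
    ∑ (λ x → if not (blocked σ x) then freeCount (insertAt x M σ) else 0) (slots σ) + (α + β) * (α + β)
      ≡ (α + β) * suc (freeCount σ) + (α + β) * freeCount σ
  ∑-freeCount-insertAt {M} {σ} σ<M α+β≤ = begin
    ∑ (λ x → if not (blocked σ x) then freeCount (insertAt x M σ) else 0) (slots σ) + c * c
      ≡⟨ cong (_+ c * c) (∑-cong (slots σ) (freeCount-child σ<M α+β≤ ∘ ≤-pred ∘ ∈-downFrom⁻)) ⟩
    ∑ (λ x → suc fc * 𝟙 (not (F x)) + c * 𝟙 (F x ∧ not (blocked σ x))) (slots σ) + c * c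
      ≡⟨ cong (_+ c * c) (∑-+ (λ x → suc fc * 𝟙 (not (F x))) (λ x → c * 𝟙 (F x ∧ not (blocked σ x))) (slots σ)) ⟩
    ∑ (λ x → suc fc * 𝟙 (not (F x))) (slots σ) + ∑ (λ x → c * 𝟙 (F x ∧ not (blocked σ x))) (slots σ)
      + c * c
      ≡⟨ cong (_+ c * c) (cong₂ _+_ (∑-* (suc fc) (𝟙 ∘ not ∘ F) (slots σ)) (∑-* c _ (slots σ))) ⟩
    suc fc * count (not ∘ F) (slots σ) + c * m + c * c
      ≡⟨ cong (λ a → suc fc * a + c * m + c * c) (unflanked-count σ<M α+β≤) ⟩
    suc fc * c + c * m + c * c
      ≡⟨ +-assoc (suc fc * c) (c * m) (c * c) ⟩
    suc fc * c + (c * m + c * c)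
      ≡⟨ cong₂ _+_ (*-comm (suc fc) c) (trans (sym (*-distribˡ-+ c m c)) (cong (c *_) (+-comm m c))) ⟩
    c * suc fc + c * (c + m)
      ≡⟨ cong (λ a → c * suc fc + c * a) (sym (freeCount-split σ<M α+β≤)) ⟩
    c * suc fc + c * fc ∎
    where
    open ≡-Reasoning
    c = α + β
    F = slotFlanked σ M
    fc = freeCount σ
    m = count (λ x → F x ∧ not (blocked σ x)) (slots σ)

  flanked-intro : ∀ {u zs ws xs ys} → All (_< u) xs → length xs ≡ α → xs ⊆ zs →
    All (_< u) ys → length ys ≡ β → ys ⊆ ws → flanked u zs ws ≡ true
  flanked-intro xs<u |xs| xs⊆ ys<u |ys| ys⊆ = cong₂ _∧_
    (dec-true (α ≤? _) (subst (_≤ _) |xs| (length≤below xs<u xs⊆)))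
    (dec-true (β ≤? _) (subst (_≤ _) |ys| (length≤below ys<u ys⊆)))

  flanked-elim : ∀ u xs ys → flanked u xs ys ≡ true → α ≤ below u xs × β ≤ below u ys
  flanked-elim u xs ys eq with e₁ , e₂ ← ∧-≡-true {does (α ≤? below u xs)} eq =
    ≤ᵇ⇒≤ α _ (Equivalence.from T-≡ e₁) , ≤ᵇ⇒≤ β _ (Equivalence.from T-≡ e₂)

  occurrence-insertAt : ∀ {σ} j M → Occurrence σ → Occurrence (insertAt j M σ)
  occurrence-insertAt {σ} j M (occurrence xs p q ys embeds |xs| |ys| <p <q) =
    occurrence xs p q ys (⊆-trans embeds (⊆-insertAt j M σ)) |xs| |ys| <p <q

  blocked⇒occurrence : ∀ {M σ} j → All (_< M) σ → blocked σ j ≡ true → Occurrence (insertAt j M σ)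
  blocked⇒occurrence {M} {σ} j σ<M eq
    with r , r∈ , blocks-r ← any-witness (blocks σ j) _ eq
    with deep-r , flanked-j ← ∧-≡-true {deep σ r} blocks-r
    with α≤before-r , β≤after-r ← flanked-elim (nth r σ) (take r σ) (drop (suc r) σ) deep-r
       | α≤before-j , β≤after-j ← flanked-elim (nth r σ) (take j σ) (drop j σ) flanked-j
    with r <? j
  ... | yes r<j
    with xs , xs⊆ , |xs| , xs<u ← sublist-below α (nth r σ) (take r σ) α≤before-r
       | ys , ys⊆ , |ys| , ys<u ← sublist-below β (nth r σ) (drop j σ) β≤after-j =
    occurrence xs u M ys embeds |xs| |ys| (Allₚ.++⁺ xs<u ys<u) (Allₚ.++⁺ (raise xs<u) (raise ys<u))
    where
    u = nth r σ
    u<M = All-nth σ<M (∈-downFrom⁻ r∈)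
    raise : ∀ {zs} → All (_< u) zs → All (_< M) zs
    raise = All.map (λ z<u → <-trans z<u u<M)
    embeds : xs ++ u ∷ M ∷ ys ⊆ insertAt j M σ
    embeds = subst₂ _⊆_ (++-assoc xs [ u ] (M ∷ ys)) (sym (insertAt≡take++drop j M σ))
      (Sublist.++⁺ (⊆-trans (∷ʳ-⊆-take σ xs⊆ (∈-downFrom⁻ r∈)) (Sublist.take⁺ r<j)) (refl ∷ ys⊆))
  ... | no r≮j
    with xs , xs⊆ , |xs| , xs<u ← sublist-below α (nth r σ) (take j σ) α≤before-j
       | ys , ys⊆ , |ys| , ys<u ← sublist-below β (nth r σ) (drop (suc r) σ) β≤after-r =
    occurrence xs M u ys embeds |xs| |ys| (Allₚ.++⁺ (raise xs<u) (raise ys<u)) (Allₚ.++⁺ xs<u ys<u)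
    where
    u = nth r σ
    u<M = All-nth σ<M (∈-downFrom⁻ r∈)
    raise : ∀ {zs} → All (_< u) zs → All (_< M) zs
    raise = All.map (λ z<u → <-trans z<u u<M)
    embeds : xs ++ M ∷ u ∷ ys ⊆ insertAt j M σ
    embeds = subst (xs ++ M ∷ u ∷ ys ⊆_) (sym (insertAt≡take++drop j M σ))
      (Sublist.++⁺ xs⊆ (refl ∷ ⊆-trans (∷-⊆-drop σ ys⊆ (∈-downFrom⁻ r∈)) (Sublist.drop⁺-≥ (≮⇒≥ r≮j))))

  blocks-intro : ∀ {σ j r xs ys} → All (_< nth r σ) xs → length xs ≡ α → All (_< nth r σ) ys → length ys ≡ β →
    xs ⊆ take r σ → ys ⊆ drop (suc r) σ → xs ⊆ take j σ → ys ⊆ drop j σ → blocks σ j r ≡ true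
  blocks-intro xs<u |xs| ys<u |ys| xs⊆r ys⊆r xs⊆j ys⊆j =
    cong₂ _∧_ (flanked-intro xs<u |xs| xs⊆r ys<u |ys| ys⊆r) (flanked-intro xs<u |xs| xs⊆j ys<u |ys| ys⊆j)

  blocked-by-later : ∀ {σ j q xs ys} → j ≤ length σ → All (_< q) xs → length xs ≡ α → All (_< q) ys → length ys ≡ β →
    xs ⊆ take j σ → q ∷ ys ⊆ drop j σ → blocked σ j ≡ true
  blocked-by-later {σ} {j} {q} {xs} {ys} j≤n xs<q |xs| ys<q |ys| xs⊆ q∷ys⊆
    with r′ , r′<n , nth≡q , ys⊆ ← first-position (drop j σ) q∷ys⊆ =
    any-intro (blocks σ j) (∈-downFrom⁺ r<n)
      (blocks-intro (subst (λ u → All (_< u) xs) (sym nth≡) xs<q) |xs|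
                    (subst (λ u → All (_< u) ys) (sym nth≡) ys<q) |ys|
                    (⊆-trans xs⊆ (Sublist.take⁺ (m≤m+n j r′)))
                    (subst (ys ⊆_) (trans (drop-drop j (suc r′) σ) (cong (λ n → drop n σ) (+-suc j r′))) ys⊆)
                    xs⊆
                    (⊆-trans ys⊆ (Sublist.drop-⊆ (suc r′) (drop j σ))))
    where
    nth≡ : nth (j + r′) σ ≡ q
    nth≡ = trans (nth-+-drop j r′ σ) nth≡q
    r<n : j + r′ < length σ
    r<n = subst (j + r′ <_) (trans (cong (j +_) (length-drop j σ)) (m+[n∸m]≡n j≤n)) (+-monoʳ-< j r′<n)

  blocked-by-earlier : ∀ {σ j p xs ys} → All (_< p) xs → length xs ≡ α → All (_< p) ys → length ys ≡ β →
    xs ++ [ p ] ⊆ take j σ → ys ⊆ drop j σ → blocked σ j ≡ true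
  blocked-by-earlier {σ} {j} {p} {xs} {ys} xs<p |xs| ys<p |ys| xs∷p⊆ ys⊆
    with r , r<|take| , nth≡p , xs⊆ ← last-position xs (take j σ) xs∷p⊆ =
    any-intro (blocks σ j) (∈-downFrom⁺ r<n)
      (blocks-intro (subst (λ u → All (_< u) xs) (sym nth≡) xs<p) |xs|
                    (subst (λ u → All (_< u) ys) (sym nth≡) ys<p) |ys|
                    xs⊆r
                    (⊆-trans ys⊆ (Sublist.drop⁺-≥ r<j))
                    (⊆-trans xs⊆r (Sublist.take⁺ (<⇒≤ r<j)))
                    ys⊆)
    where
    r<j⊓n : r < j ⊓ length σ
    r<j⊓n = subst (r <_) (length-take j σ) r<|take|
    r<j = <-≤-trans r<j⊓n (m⊓n≤m j (length σ))
    r<n = <-≤-trans r<j⊓n (m⊓n≤n j (length σ))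
    nth≡ : nth r σ ≡ p
    nth≡ = trans (sym (nth-take σ r<j)) nth≡p
    xs⊆r : xs ⊆ take r σ
    xs⊆r = subst (xs ⊆_) (trans (take-take r j σ) (cong (λ n → take n σ) (m≤n⇒m⊓n≡m (<⇒≤ r<j)))) xs⊆

  -- An occurrence through the new maximum M uses it as one of its two large entries.
  occurrence-insertAt⁻ : ∀ {M σ} j → All (_< M) σ → j ≤ length σ →
    Occurrence (insertAt j M σ) → Occurrence σ ⊎ blocked σ j ≡ true
  occurrence-insertAt⁻ {M} {σ} j σ<M j≤n (occurrence xs p q ys embeds |xs| |ys| <p <q)
    with ⊆-++-∷ (take j σ) (drop j σ) (subst (_ ⊆_) (insertAt≡take++drop j M σ) embeds)
  ... | inj₁ embeds′ = inj₁ (occurrence xs p q ys (subst (_ ⊆_) (take++drop≡id j σ) embeds′) |xs| |ys| <p <q)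
  ... | inj₂ (s₁ , s₂ , eq , s₁⊆ , s₂⊆)
    with xs<p , ys<p ← Allₚ.++⁻ xs <p | xs<q , ys<q ← Allₚ.++⁻ xs <q
    with locate-top xs ys s₁ s₂ eq (All.map (λ z<p → <-≤-trans z<p p≤M) xs<p)
                                   (All.map (λ z<p → <-≤-trans z<p p≤M) ys<p)
    where
    p≤M : p ≤ M
    p≤M with p≤M ∷ _ ← Allₚ.++⁻ʳ xs (Sublist.All-resp-⊆ embeds (All-insertAt j ≤-refl (<⇒≤-All σ<M))) = p≤M
  ... | inj₁ (refl , refl , refl) = inj₂ (blocked-by-later j≤n xs<q |xs| ys<q |ys| s₁⊆ s₂⊆)
  ... | inj₂ (refl , refl , refl) = inj₂ (blocked-by-earlier xs<p |xs| ys<p |ys| s₁⊆ s₂⊆)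

  Avoids : List ℕ → Set
  Avoids = AvoidsCBP (2 + α + β) (Pair (suc α))

  avoids-insertAt : ∀ {n σ} j → IsPermOf n σ → j ≤ n →
    Avoids (insertAt j (suc n) σ) ⇔ (Avoids σ × blocked σ j ≡ false)
  avoids-insertAt {n} {σ} j σ↭ j≤n = mk⇔ to from
    where
    σ<M = IsPermOf-All σ↭
    to : Avoids (insertAt j (suc n) σ) → Avoids σ × blocked σ j ≡ false
    to avoids with blocked σ j in eq
    ... | true  = contradiction (occurrence⇒OccursCBP (blocked⇒occurrence j σ<M eq)) avoids
    ... | false = avoids ∘ occurrence⇒OccursCBP ∘ occurrence-insertAt j (suc n) ∘ OccursCBP⇒occurrence , refl
    from : Avoids σ × blocked σ j ≡ false → Avoids (insertAt j (suc n) σ)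
    from (avoids , unblocked) occurs
      with occurrence-insertAt⁻ j σ<M (subst (j ≤_) (sym (IsPermOf-length σ↭)) j≤n)
                                (OccursCBP⇒occurrence occurs)
    ... | inj₁ occ    = avoids (occurrence⇒OccursCBP occ)
    ... | inj₂ blocks = contradiction (trans (sym blocks) unblocked) λ ()

  freeSlots : List ℕ → List ℕ
  freeSlots σ = filterᵇ (not ∘ blocked σ) (slots σ)

  extend : ℕ → List ℕ → ℕ → List ℕ
  extend n σ j = insertAt j (suc n) σ

  avoiders : ℕ → List (List ℕ)
  avoiders zero    = [ [] ]
  avoiders (suc n) = concatMap (λ σ → map (extend n σ) (freeSlots σ)) (avoiders n)

  ∈-freeSlots⁻ : ∀ σ {j} → j ∈ freeSlots σ → j ≤ length σ × blocked σ j ≡ false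
  ∈-freeSlots⁻ σ j∈ with j∈slots , free ← ∈-filter⁻ (T? ∘ not ∘ blocked σ) j∈ =
    ≤-pred (∈-downFrom⁻ j∈slots) , Equivalence.to T-not-≡ free

  ∈-freeSlots⁺ : ∀ σ {j} → j ≤ length σ → blocked σ j ≡ false → j ∈ freeSlots σ
  ∈-freeSlots⁺ σ j≤n free =
    ∈-filter⁺ (T? ∘ not ∘ blocked σ) (∈-downFrom⁺ (s≤s j≤n)) (Equivalence.from T-not-≡ free)

  avoiders-sound : ∀ n {w} → w ∈ avoiders n → IsPermOf n w × Avoids w
  avoiders-sound zero    (here refl) = ↭-refl , λ (s , s⊆[] , |s| , _) →
    contradiction (subst (_≤ 0) |s| (Sublist.length-mono-≤ s⊆[])) λ ()
  avoiders-sound (suc n) w∈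
    with σ , j , σ∈ , j∈ , refl ← ∈-concatMap-map⁻ (extend n) freeSlots w∈
    with σ↭ , avoids ← avoiders-sound n σ∈
    with j≤|σ| , free ← ∈-freeSlots⁻ σ j∈
    with j≤n ← subst (j ≤_) (IsPermOf-length σ↭) j≤|σ| =
    IsPermOf-insertAt j σ↭ , Equivalence.from (avoids-insertAt j σ↭ j≤n) (avoids , free)

  avoiders-complete : ∀ n {w} → IsPermOf n w × Avoids w → w ∈ avoiders n
  avoiders-complete zero    (w↭ , _) rewrite ↭-empty-inv w↭ = here refl
  avoiders-complete (suc n) (w↭ , avoids)
    with j , σ , j≤n , σ↭ , refl ← IsPermOf-remove-max w↭
    with avoids′ , free ← Equivalence.to (avoids-insertAt j σ↭ j≤n) avoids =
    ∈-concatMap-map⁺ (extend n) freeSlots (avoiders-complete n (σ↭ , avoids′))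
      (∈-freeSlots⁺ σ (subst (j ≤_) (sym (IsPermOf-length σ↭)) j≤n) free)

  avoiders-unique : ∀ n → Unique (avoiders n)
  avoiders-unique zero    = [] ∷ []
  avoiders-unique (suc n) = Unique-concatMap-map (extend n) freeSlots (avoiders-unique n)
    (λ {σ} _ → Unique.filter⁺ (T? ∘ not ∘ blocked σ) (Unique.downFrom⁺ _))
    λ {σ} {σ′} σ∈ σ′∈ j∈ j′∈ eq → swap (insertAt-injective (entries σ∈) (entries σ′∈)
                                 (proj₁ (∈-freeSlots⁻ σ j∈)) (proj₁ (∈-freeSlots⁻ σ′ j′∈)) eq)
    where
    entries : ∀ {σ} → σ ∈ avoiders n → All (_< suc n) σ
    entries = IsPermOf-All ∘ proj₁ ∘ avoiders-sound n

  length-avoiders-suc : ∀ n → length (avoiders (suc n)) ≡ ∑ freeCount (avoiders n)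
  length-avoiders-suc n = trans (length-concatMap (λ σ → map (extend n σ) (freeSlots σ)) (avoiders n))
    (∑-cong (avoiders n) λ {σ} _ →
      trans (length-map (extend n σ) (freeSlots σ)) (length-filterᵇ (not ∘ blocked σ) (slots σ)))

  ∑-freeCount-avoiders-suc : ∀ n → ∑ freeCount (avoiders (suc n)) ≡
    ∑ (λ σ → ∑ (λ x → if not (blocked σ x) then freeCount (extend n σ x) else 0) (slots σ)) (avoiders n)
  ∑-freeCount-avoiders-suc n = trans (∑-concatMap freeCount (λ σ → map (extend n σ) (freeSlots σ)) (avoiders n))
    (∑-cong (avoiders n) λ {σ} _ →
      trans (∑-map freeCount (extend n σ) (freeSlots σ))
            (∑-filterᵇ (freeCount ∘ extend n σ) (not ∘ blocked σ) (slots σ)))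

  avoiders-recurrence : ∀ n → α + β ≤ suc n →
    length (avoiders (2 + n)) + length (avoiders n) * ((α + β) * (α + β))
      ≡ (α + β) * (length (avoiders (suc n)) + length (avoiders n)) + (α + β) * length (avoiders (suc n))
  avoiders-recurrence n c≤1+n = begin
    length (avoiders (2 + n)) + length (avoiders n) * (c * c)
      ≡⟨ cong₂ _+_ (trans (length-avoiders-suc (suc n)) (∑-freeCount-avoiders-suc n))
                   (sym (∑-const (c * c) (avoiders n))) ⟩
    ∑ children (avoiders n) + ∑ (λ _ → c * c) (avoiders n)
      ≡⟨ sym (∑-+ children (λ _ → c * c) (avoiders n)) ⟩
    ∑ (λ σ → children σ + c * c) (avoiders n)
      ≡⟨ ∑-cong (avoiders n) (λ σ∈ →
           ∑-freeCount-insertAt (entries σ∈) (subst (c ≤_) (cong suc (sym (|σ| σ∈))) c≤1+n)) ⟩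
    ∑ (λ σ → c * suc (freeCount σ) + c * freeCount σ) (avoiders n)
      ≡⟨ ∑-+ (λ σ → c * suc (freeCount σ)) (λ σ → c * freeCount σ) (avoiders n) ⟩
    ∑ (λ σ → c * suc (freeCount σ)) (avoiders n) + ∑ (λ σ → c * freeCount σ) (avoiders n)
      ≡⟨ cong₂ _+_ (∑-* c (λ σ → suc (freeCount σ)) (avoiders n)) (∑-* c freeCount (avoiders n)) ⟩
    c * ∑ (λ σ → suc (freeCount σ)) (avoiders n) + c * ∑ freeCount (avoiders n)
      ≡⟨ cong₂ (λ a b → c * a + c * b) ∑-suc (sym (length-avoiders-suc n)) ⟩
    c * (length (avoiders (suc n)) + length (avoiders n)) + c * length (avoiders (suc n)) ∎
    where
    open ≡-Reasoning
    c = α + β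
    children : List ℕ → ℕ
    children σ = ∑ (λ x → if not (blocked σ x) then freeCount (extend n σ x) else 0) (slots σ)
    entries : ∀ {σ} → σ ∈ avoiders n → All (_< suc n) σ
    entries = IsPermOf-All ∘ proj₁ ∘ avoiders-sound n
    |σ| : ∀ {σ} → σ ∈ avoiders n → length σ ≡ n
    |σ| = IsPermOf-length ∘ proj₁ ∘ avoiders-sound n
    ∑-suc : ∑ (λ σ → suc (freeCount σ)) (avoiders n) ≡ length (avoiders (suc n)) + length (avoiders n)
    ∑-suc = begin
      ∑ (λ σ → 1 + freeCount σ) (avoiders n)
        ≡⟨ ∑-+ (λ _ → 1) freeCount (avoiders n) ⟩
      ∑ (λ _ → 1) (avoiders n) + ∑ freeCount (avoiders n)
        ≡⟨ cong₂ _+_ (trans (∑-const 1 (avoiders n)) (*-identityʳ _)) (sym (length-avoiders-suc n)) ⟩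
      length (avoiders n) + length (avoiders (suc n))
        ≡⟨ +-comm (length (avoiders n)) _ ⟩
      length (avoiders (suc n)) + length (avoiders n) ∎

  unblocked-when-short : ∀ {n σ} x → IsPermOf n σ → suc n < 2 + α + β → blocked σ x ≡ false
  unblocked-when-short {n} {σ} x σ↭ short with blocked σ x in eq
  ... | false = refl
  ... | true with s , s⊆ , |s| , _ ← occurrence⇒OccursCBP (blocked⇒occurrence x (IsPermOf-All σ↭) eq) =
    contradiction (subst (_≤ suc n) |s| (≤-trans (Sublist.length-mono-≤ s⊆) (≤-reflexive |σ′|))) (<⇒≱ short)
    where
    |σ′| : length (insertAt x (suc n) σ) ≡ suc n
    |σ′| = trans (length-insertAt x (suc n) σ) (cong suc (IsPermOf-length σ↭))

  length-avoiders-short : ∀ n → suc n < 2 + α + β → length (avoiders (suc n)) ≡ length (avoiders n) * suc n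
  length-avoiders-short n short = begin
    length (avoiders (suc n))               ≡⟨ length-avoiders-suc n ⟩
    ∑ freeCount (avoiders n)                ≡⟨ ∑-cong (avoiders n) (all-free ∘ proj₁ ∘ avoiders-sound n) ⟩
    ∑ (λ _ → suc n) (avoiders n)            ≡⟨ ∑-const (suc n) (avoiders n) ⟩
    length (avoiders n) * suc n             ∎
    where
    open ≡-Reasoning
    all-free : ∀ {σ} → IsPermOf n σ → freeCount σ ≡ suc n
    all-free {σ} σ↭ = begin
      count (not ∘ blocked σ) (slots σ)
        ≡⟨ count-all _ (slots σ) (λ {x} _ → cong not (unblocked-when-short x σ↭ short)) ⟩
      length (slots σ)
        ≡⟨ length-downFrom (suc (length σ)) ⟩
      suc (length σ)
        ≡⟨ cong suc (IsPermOf-length σ↭) ⟩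
      suc n ∎

  length-avoiders-factorial : ∀ n → n < 2 + α + β → length (avoiders n) ≡ n !
  length-avoiders-factorial zero    _     = refl
  length-avoiders-factorial (suc n) short = begin
    length (avoiders (suc n))    ≡⟨ length-avoiders-short n short ⟩
    length (avoiders n) * suc n  ≡⟨ cong (_* suc n) (length-avoiders-factorial n (<-trans (n<1+n n) short)) ⟩
    n ! * suc n                  ≡⟨ *-comm (n !) (suc n) ⟩
    suc n !                      ∎
    where open ≡-Reasoning

  NumberOf-avoiders : ∀ n {a} → NumberOf (λ w → IsPermOf n w × Avoids w) a → a ≡ length (avoiders n)
  NumberOf-avoiders n (L , L! , ∈L⇔ , refl) = ↭-length (∼bag⇒↭ (unique∧set⇒bag L! (avoiders-unique n)
    λ {w} → mk⇔ (avoiders-complete n ∘ Equivalence.to (∈L⇔ w))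
                (Equivalence.from (∈L⇔ w) ∘ avoiders-sound n)))

  avoiders-count : (a : ℕ → ℕ) → (∀ n → NumberOf (λ w → IsPermOf n w × Avoids w) (a n)) →
    (∀ n → n < 2 + α + β → a n ≡ n !) ×
    (∀ n → 2 + α + β ≤ n → a n + (α + β) * (α + β ∸ 1) * a (n ∸ 2) ≡ 2 * (α + β) * a (n ∸ 1))
  avoiders-count a a-counts = small , large
    where
    a≡ : ∀ n → a n ≡ length (avoiders n)
    a≡ n = NumberOf-avoiders n (a-counts n)
    small : ∀ n → n < 2 + α + β → a n ≡ n !
    small n short = trans (a≡ n) (length-avoiders-factorial n short)
    large : ∀ n → 2 + α + β ≤ n → a n + (α + β) * (α + β ∸ 1) * a (n ∸ 2) ≡ 2 * (α + β) * a (n ∸ 1)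
    large (suc (suc m)) (s≤s (s≤s c≤m)) rewrite a≡ (suc (suc m)) | a≡ m | a≡ (suc m) =
      cancel-recurrence (α + β) _ _ _ (avoiders-recurrence m (m≤n⇒m≤1+n c≤m))

theorem4 : (k i : ℕ) → 3 ≤ k → 1 ≤ i → i ≤ k ∸ 1 →
  (a : ℕ → ℕ) →
  (∀ n → NumberOf (λ w → IsPermOf n w × AvoidsCBP k (Pair i) w) (a n)) →
  (∀ n → n < k → a n ≡ n !) ×
  (∀ n → k ≤ n →
    a n + (k ∸ 2) * (k ∸ 3) * a (n ∸ 2) ≡ 2 * (k ∸ 2) * a (n ∸ 1))
theorem4 (suc (suc c)) (suc α) _ _ (s≤s α≤c) a rewrite sym (m+[n∸m]≡n α≤c) =
  Pattern.avoiders-count α (c ∸ α) a
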